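{- Let $\mathcal R$ be a completely defined, orthogonal constructor TRS compatible with the Path Order for ETIME via the precedence $\sqsupset$, and let $\sigma:\mathcal V\to\mathrm{Val}$ be a substitution. Then for every rule $l\to r\in\mathcal R$, $\pi(l\sigma)\blacktriangleright_{|r|}\pi(r\sigma)$, where $\blacktriangleright_{|r|}$ is taken with respect to the precedence $\sqsupset_\ell$ on $\mathcal F^{\mathsf n}$.
   Context: $\mathcal F=\mathcal C\uplus\mathcal D$ finite signature, values $\mathrm{Val}$ ground constructor terms, $|t|$ the number of symbol occurrences of $t$. Argument positions are split into normal and safe, $f(s_1,\dots,s_k;s_{k+1},\dots,s_{k+l})$; constructors have only safe arguments. TRS: finite set of rules $f(l_1,\dots,l_n)\to r$, $f\in\mathcal D$; completely defined orthogonal constructor: $l_i$ contain no defined symbols, left-hand sides linear, each $f(v_1,\dots,v_n)$ with values $v_i$ matches exactly one rule. Compatibility: $l>_{\mathsf{poe}}r$ for all rules, where $s=f(s_1,\dots,s_k;s_{k+1},\dots,s_{k+l})>_{\mathsf{poe}}t$ iff (1) $s_i\ge_{\mathsf{poe}}t$ for some $i$; or (2) $f\in\mathcal D$, $t=g(t_1,\dots,t_m;t_{m+1},\dots,t_{m+n})$, $f\sqsupset g$, each $t_j$ ($j\le m$) is a subterm of a normal argument of $s$, $s>_{\mathsf{poe}}t_j$ for $j>m$; or (3) $f\in\mathcal D$, $t=f(t_1,\dots,t_k;t_{k+1},\dots,t_{k+l})$, $(s_1,\dots,s_k)>^{\mathrm{prod}}_{\mathsf{poe}}(t_1,\dots,t_k)$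 (componentwise $\ge$, strict somewhere), $s>_{\mathsf{poe}}t_j$ for $j>k$. Normalised signature: for each $f\in\mathcal F$ with $k$ normal arguments, $f^{\mathsf n}$ is a fresh symbol of arity $k$; $\mathcal F^{\mathsf n}=\mathcal F\cup\{f^{\mathsf n}\mid f\in\mathcal F\}$; precedence $\sqsupset_\ell$ on $\mathcal F^{\mathsf n}$: $f^{\mathsf n}\sqsupset_\ell g^{\mathsf n}$ iff $f\sqsupset g$, and $f\sqsupset_\ell g$ iff $f\sqsupset g$. Predicative interpretation: $\pi(t)=[\,]$ (empty sequence) if $t\in\mathrm{Val}$, and $\pi(f(t_1,\dots,t_k;t_{k+1},\dots,t_{k+l}))=f^{\mathsf n}(t_1,\dots,t_k)\mathbin{+\!\!+}\pi(t_{k+1})\mathbin{+\!\!+}\cdots\mathbin{+\!\!+}\pi(t_{k+l})$ otherwise. Sequences: with a fresh variadic symbol $\mathsf{list}$, $[t_1\cdots t_k]=\mathsf{list}(t_1,\dots,t_k)$; concatenation $[s_1\cdots s_k]\mathbin{+\!\!+}[t_1\cdots t_l]=[s_1\cdots s_k\,t_1\cdots t_l]$, terms identified with singleton sequences. $\rhd$ strict superterm. For $\ell'\ge1$ and precedence $\sqsupset_\ell$, $a\blacktriangleright_{\ell'}b$ iff: (1) $a=f(s_1,\dots,s_k)$, $b=g(t_1,\dots,t_l)$, $f\sqsupset_\ell g$, $a\rhd t_j$ for all $j$, $l\le\ell'$; or (2) $a=f(s_1,\dots,s_k)$, $b=f(t_1,\dots,t_k)$, $(s_i)\rhd^{\mathrm{prod}}(t_i)$;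 or (3) $a=f(s_1,\dots,s_k)$, $b=[t_1\cdots t_l]$, $a\blacktriangleright_{\ell'}t_j$ for all $j$, $l\le\ell'$; or (4) $a=[s_1\cdots s_k]$, $b=[t_1\cdots t_l]=b_1\mathbin{+\!\!+}\cdots\mathbin{+\!\!+}b_k$ with $(s_1,\dots,s_k)\blacktriangleright_{\ell'}^{\mathrm{prod}}(b_1,\dots,b_k)$. -}

module Defs where

open import Data.Nat using (ℕ; zero; suc; _+_; _≤_)
open import Data.Bool using (Bool; true; false; _∧_; if_then_else_)
open import Data.Empty using (⊥)
open import Data.Sum using (_⊎_; inj₁; inj₂)
open import Data.Product using (Σ; ∃; _×_; _,_)
open import Data.Fin using (Fin)
open import Data.List using (List; []; _∷_; _++_; length; lookup; take; drop; concat)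
open import Data.List.Relation.Binary.Pointwise using (Pointwise)
open import Data.List.Relation.Unary.All using (All)
open import Data.List.Membership.Propositional using (_∈_)
open import Data.List.Relation.Unary.Unique.Propositional using (Unique)
open import Relation.Binary.PropositionalEquality using (_≡_)
open import Relation.Binary.Structures using (IsStrictPartialOrder)

data ProdExt {A B : Set} (R≥ R> : A → B → Set) : List A → List B → Set where
  here  : ∀ {x y xs ys} → R> x y → Pointwise R≥ xs ys → ProdExt R≥ R> (x ∷ xs) (y ∷ ys)
  there : ∀ {x y xs ys} → R≥ x y → ProdExt R≥ R> xs ys → ProdExt R≥ R> (x ∷ xs) (y ∷ ys)

record Signature : Set₁ where
  field
    Sym       : Set
    finite    : Σ (List Sym) (λ xs → ∀ f → f ∈ xs)
    isDefined : Sym → Bool          -- true: f ∈ D, false: f ∈ C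
    nrm       : Sym → ℕ
    sf        : Sym → ℕ
    constr-safe : ∀ f → isDefined f ≡ false → nrm f ≡ 0

  arity : Sym → ℕ
  arity f = nrm f + sf f

open Signature public

-- Terms over a signature with variables V.  Arguments are listed
-- normal ones first: f(s₁,…,s_k ; s_{k+1},…,s_{k+l}).

data Term (S : Signature) (V : Set) : Set where
  var : V → Term S V
  app : Sym S → List (Term S V) → Term S V

module _ {S : Signature} where

  mutual
    _⟨_⟩ : {V W : Set} → Term S V → (V → Term S W) → Term S W
    var x ⟨ τ ⟩ = τ x
    app f ts ⟨ τ ⟩ = app f (substs ts τ)

    substs : {V W : Set} → List (Term S V) → (V → Term S W) → List (Term S W)
    substs [] τ = []
    substs (t ∷ ts) τ = (t ⟨ τ ⟩) ∷ substs ts τ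

  mutual
    size : {V : Set} → Term S V → ℕ
    size (var x) = 1
    size (app f ts) = suc (sizes ts)

    sizes : {V : Set} → List (Term S V) → ℕ
    sizes [] = 0
    sizes (t ∷ ts) = size t + sizes ts

  mutual
    vars : {V : Set} → Term S V → List V
    vars (var x) = x ∷ []
    vars (app f ts) = varss ts

    varss : {V : Set} → List (Term S V) → List V
    varss [] = []
    varss (t ∷ ts) = vars t ++ varss ts

  data WF {V : Set} : Term S V → Set where
    wf-var : ∀ {x} → WF (var x)
    wf-app : ∀ {f ts} → length ts ≡ arity S f → All WF ts → WF (app f ts)

  data NoDef {V : Set} : Term S V → Set where
    nd-var : ∀ {x} → NoDef (var x)
    nd-app : ∀ {f ts} → isDefined S f ≡ false → All NoDef ts → NoDef (app f ts)

  IsVal : Term S ⊥ → Set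
  IsVal t = WF t × NoDef t

  mutual
    noDefB : {V : Set} → Term S V → Bool
    noDefB (var x) = true
    noDefB (app f ts) = (if isDefined S f then false else true) ∧ noDefBs ts

    noDefBs : {V : Set} → List (Term S V) → Bool
    noDefBs [] = true
    noDefBs (t ∷ ts) = noDefB t ∧ noDefBs ts

  data _⊵_ {V : Set} : Term S V → Term S V → Set where
    ⊵-refl : ∀ {s} → s ⊵ s
    ⊵-arg  : ∀ {f ts t} (i : Fin (length ts)) → lookup ts i ⊵ t → app f ts ⊵ t

  module POE (_⊐_ : Sym S → Sym S → Set) {V : Set} where

    mutual
      _≥poe_ : Term S V → Term S V → Set
      s ≥poe t = s ≡ t ⊎ s >poe t

      data _>poe_ : Term S V → Term S V → Set where
        poe1 : ∀ {f ss t} (i : Fin (length ss)) →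
               (lookup ss i ≡ t ⊎ lookup ss i >poe t) → app f ss >poe t
        poe2 : ∀ {f ss g ts} → isDefined S f ≡ true → f ⊐ g →
               (∀ (j : Fin (length (take (nrm S g) ts))) →
                  ∃ λ (i : Fin (length (take (nrm S f) ss))) →
                    lookup (take (nrm S f) ss) i ⊵ lookup (take (nrm S g) ts) j) →
               (∀ (j : Fin (length (drop (nrm S g) ts))) →
                  app f ss >poe lookup (drop (nrm S g) ts) j) →
               app f ss >poe app g ts
        poe3 : ∀ {f ss ts} → isDefined S f ≡ true →
               ProdExt (λ a b → a ≡ b ⊎ a >poe b) _>poe_
                       (take (nrm S f) ss) (take (nrm S f) ts) →
               (∀ (j : Fin (length (drop (nrm S f) ts))) →
                  app f ss >poe lookup (drop (nrm S f) ts) j) →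
               app f ss >poe app f ts

  record Rule (V : Set) : Set where
    constructor _⇒_
    field
      lhs : Term S V
      rhs : Term S V
  open Rule public

  record ConstructorRule {V : Set} (ρ : Rule V) : Set where
    field
      root      : Sym S
      args      : List (Term S V)
      lhs-shape : lhs ρ ≡ app root args
      root-def  : isDefined S root ≡ true
      args-cons : All NoDef args
      linear    : Unique (vars (lhs ρ))
      wf-lhs    : WF (lhs ρ)
      wf-rhs    : WF (rhs ρ)
      var-cond  : ∀ {x} → x ∈ vars (rhs ρ) → x ∈ vars (lhs ρ)

  Matches : {V : Set} → Rule V → Term S ⊥ → Set
  Matches {V} ρ t = Σ (V → Term S ⊥) (λ τ → lhs ρ ⟨ τ ⟩ ≡ t)

  record CDOC {V : Set} (R : List (Rule V)) : Set where
    field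
      constructorRules : ∀ {ρ} → ρ ∈ R → ConstructorRule ρ
      completeUnique   : ∀ f → isDefined S f ≡ true →
                         ∀ (vs : List (Term S ⊥)) → length vs ≡ arity S f → All IsVal vs →
                         (Σ (Rule V) λ ρ → ρ ∈ R × Matches ρ (app f vs)) ×
                         (∀ {ρ ρ′} → ρ ∈ R → ρ′ ∈ R →
                            Matches ρ (app f vs) → Matches ρ′ (app f vs) → ρ ≡ ρ′)

  Compatible : (_⊐_ : Sym S → Sym S → Set) {V : Set} → List (Rule V) → Set
  Compatible _⊐_ R = ∀ {ρ} → ρ ∈ R → POE._>poe_ _⊐_ (lhs ρ) (rhs ρ)

-- Normalised signature F^n = F ∪ {f^n}; inj₁ f = f, inj₂ f = f^n
-- (arity of f^n is nrm f).  Sequences are lists of such terms; the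
-- variadic symbol list is represented by the list itself, a term t being
-- identified with the singleton sequence [t].

NSym : Signature → Set
NSym S = Sym S ⊎ Sym S

data NTerm (S : Signature) : Set where
  nd : NSym S → List (NTerm S) → NTerm S

Seq : Signature → Set
Seq S = List (NTerm S)

[_] : ∀ {S} → NTerm S → Seq S
[ t ] = t ∷ []

module _ {S : Signature} where

  data Lift (_⊐_ : Sym S → Sym S → Set) : NSym S → NSym S → Set where
    orig : ∀ {f g} → f ⊐ g → Lift _⊐_ (inj₁ f) (inj₁ g)
    norm : ∀ {f g} → f ⊐ g → Lift _⊐_ (inj₂ f) (inj₂ g)

  mutual
    data _⊳_ : NTerm S → NTerm S → Set where
      ⊳-arg : ∀ {f ts t} (i : Fin (length ts)) → lookup ts i ⊵ₙ t → nd f ts ⊳ t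

    data _⊵ₙ_ : NTerm S → NTerm S → Set where
      ⊵ₙ-refl : ∀ {s} → s ⊵ₙ s
      ⊵ₙ-strict : ∀ {s t} → s ⊳ t → s ⊵ₙ t

  mutual
    emb : Term S ⊥ → NTerm S
    emb (app f ts) = nd (inj₁ f) (embs ts)

    embs : List (Term S ⊥) → List (NTerm S)
    embs [] = []
    embs (t ∷ ts) = emb t ∷ embs ts

  mutual
    π : Term S ⊥ → Seq S
    π (app f ts) = if noDefB (app f ts) then []
                   else nd (inj₂ f) (embs (take (nrm S f) ts)) ∷ πs (nrm S f) ts

    πs : ℕ → List (Term S ⊥) → Seq S
    πs _ [] = []
    πs zero (t ∷ ts) = π t ++ πs zero ts
    πs (suc n) (t ∷ ts) = πs n ts

  module Blacktriangle (_⊐ℓ′_ : NSym S → NSym S → Set) (ℓ′ : ℕ) where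

    data _▶_ : Seq S → Seq S → Set where
      bt1 : ∀ {f ss g ts} → f ⊐ℓ′ g → (∀ (j : Fin (length ts)) → nd f ss ⊳ lookup ts j) →
            length ts ≤ ℓ′ → [ nd f ss ] ▶ [ nd g ts ]
      bt2 : ∀ {f ss ts} → ProdExt _⊵ₙ_ _⊳_ ss ts → [ nd f ss ] ▶ [ nd f ts ]
      bt3 : ∀ {a ts} → (∀ (j : Fin (length ts)) → [ a ] ▶ [ lookup ts j ]) →
            length ts ≤ ℓ′ → [ a ] ▶ ts
      bt4 : ∀ {ss ts} (bs : List (Seq S)) → ts ≡ concat bs →
            ProdExt (λ s b → [ s ] ≡ b ⊎ [ s ] ▶ b) (λ s b → [ s ] ▶ b) ss bs →
            ss ▶ ts

  _▶[_∣_]_ : Seq S → (Sym S → Sym S → Set) → ℕ → Seq S → Set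
  a ▶[ _⊐_ ∣ ℓ′ ] b = Blacktriangle._▶_ (Lift _⊐_) ℓ′ a b

module Submission where

-- Write l = f(l₁,…,lₙ) with constructor terms lᵢ.  Then lσ has a single
-- defined symbol, so π(lσ) = [F] with F = fⁿ(l₁σ,…,l_kσ) (normal arguments).
-- The core of the proof is a lemma on single elements:
--   if l >poe t and |t| ≤ ℓ′, then [F] ▶_ℓ′ [u] for every u ∈ π(tσ).
-- It is proved by induction on the derivation of l >poe t:
--   * clause (1) only reaches subterms of constructor terms, whose π is empty;
--   * clause (2) resp. (3) produces the head gⁿ(…) of π(tσ), dominated by F via
--     rule (1) resp. (2) of ▶, because >poe between constructor terms is the
--     strict subterm relation and survives σ and the embedding into 𝓕ⁿ;
--   * all other elements of π(tσ) come from safe arguments tⱼ with l >poe tⱼ.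
-- Rule (3) of ▶ then assembles the elements, using |π(rσ)| ≤ |r|.

open import Defs
open import Data.Empty using (⊥; ⊥-elim)
open import Data.Bool using (true; false)
open import Data.Nat using (ℕ; zero; suc; _≤_; _<_; z≤n; s≤s)
open import Data.Nat.Properties using (≤-trans; ≤-refl; <⇒≤; m≤m+n; m≤n+m; +-mono-≤; m⊓n≤n)
open import Data.Fin as Fin using (Fin)
open import Data.Product using (Σ; ∃; _×_; _,_; proj₂)
open import Data.Sum using (_⊎_; inj₁; inj₂)
open import Data.List using (List; []; _∷_; length; lookup; take; drop; map)
open import Data.List.Properties using (length-++; length-map; length-take)
open import Data.List.Membership.Propositional using (_∈_)
open import Data.List.Membership.Propositional.Properties using (∈-lookup; ∈-map⁺; ∈-map⁻; ∈-++⁻)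
open import Data.List.Relation.Unary.Any using (here; there; index)
open import Data.List.Relation.Unary.Any.Properties using (¬Any[]; lookup-index)
open import Data.List.Relation.Unary.All as All using (All; []; _∷_)
open import Data.List.Relation.Unary.All.Properties using (take⁺)
open import Data.List.Relation.Binary.Pointwise using (Pointwise; []; _∷_)
open import Relation.Binary.PropositionalEquality using (_≡_; refl; sym; trans; cong; subst; subst₂)
open import Relation.Binary.Structures using (IsStrictPartialOrder)

ProdExt-map : ∀ {A B : Set} {P : A → Set} {R≥ R> : A → A → Set} {Q≥ Q> : B → B → Set}
  (h : A → B) →
  (∀ {a b} → P a → R≥ a b → Q≥ (h a) (h b)) →
  (∀ {a b} → P a → R> a b → Q> (h a) (h b)) →
  ∀ {xs ys} → All P xs → ProdExt R≥ R> xs ys → ProdExt Q≥ Q> (map h xs) (map h ys)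
ProdExt-map {P = P} {R≥ = R≥} {Q≥ = Q≥} h map≥ map> = go
  where
    pointwise : ∀ {xs ys} → All P xs → Pointwise R≥ xs ys → Pointwise Q≥ (map h xs) (map h ys)
    pointwise [] [] = []
    pointwise (p ∷ ps) (r ∷ rs) = map≥ p r ∷ pointwise ps rs

    go : ∀ {xs ys} → All P xs → ProdExt R≥ _ xs ys → ProdExt Q≥ _ (map h xs) (map h ys)
    go (p ∷ ps) (here r rs) = here (map> p r) (pointwise ps rs)
    go (p ∷ ps) (there r rs) = there (map≥ p r) (go ps rs)

module _ {S : Signature} where

  ⊳-∈ : ∀ {f u t} {ts : List (NTerm S)} → u ∈ ts → u ⊵ₙ t → nd f ts ⊳ t
  ⊳-∈ {ts = ts} u∈ts u⊵t =
    ⊳-arg (index u∈ts) (subst (_⊵ₙ _) (lookup-index u∈ts) u⊵t)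

  -- Every term has at least one symbol, so a list of terms is no longer than its size.
  length≤sizes : ∀ {V : Set} (ts : List (Term S V)) → length ts ≤ sizes ts
  length≤sizes [] = z≤n
  length≤sizes (var _ ∷ ts) = s≤s (length≤sizes ts)
  length≤sizes (app _ _ ∷ ts) = s≤s (≤-trans (length≤sizes ts) (m≤n+m _ _))

  defined≢constructor : ∀ {f} → isDefined S f ≡ true → isDefined S f ≡ false → ⊥
  defined≢constructor d c with trans (sym d) c
  ... | ()

  πHead : Sym S → List (Term S ⊥) → NTerm S
  πHead g xs = nd (inj₂ g) (embs (take (nrm S g) xs))

  π-app : ∀ g xs → π (app g xs) ≡ [] ⊎ π (app g xs) ≡ πHead g xs ∷ πs (nrm S g) xs
  π-app g xs with noDefB (app g xs)
  ... | true = inj₁ refl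
  ... | false = inj₂ refl

  ∈-π-app : ∀ {u} g xs → u ∈ π (app g xs) → u ≡ πHead g xs ⊎ u ∈ πs (nrm S g) xs
  ∈-π-app {u} g xs u∈ with π-app g xs
  ... | inj₁ empty = ⊥-elim (¬Any[] (subst (u ∈_) empty u∈))
  ... | inj₂ cons with subst (u ∈_) cons u∈
  ...   | here u≡head = inj₁ u≡head
  ...   | there u∈safe = inj₂ u∈safe

  mutual
    noDefB-constructor : ∀ {V : Set} {u : Term S V} → NoDef u → noDefB u ≡ true
    noDefB-constructor nd-var = refl
    noDefB-constructor (nd-app c args) rewrite c = noDefBs-constructor args

    noDefBs-constructor : ∀ {V : Set} {us : List (Term S V)} → All NoDef us → noDefBs us ≡ true
    noDefBs-constructor [] = refl
    noDefBs-constructor (u ∷ us) rewrite noDefB-constructor u = noDefBs-constructor us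

  π-constructor : ∀ {u : Term S ⊥} → NoDef u → π u ≡ []
  π-constructor {app f ts} u rewrite noDefB-constructor u = refl

  πs-constructor : ∀ k {us : List (Term S ⊥)} → All NoDef us → πs k us ≡ []
  πs-constructor k [] = refl
  πs-constructor zero (u ∷ us) rewrite π-constructor u = πs-constructor zero us
  πs-constructor (suc k) (_ ∷ us) = πs-constructor k us

  π-defined : ∀ {g} {xs : List (Term S ⊥)} → isDefined S g ≡ true → All NoDef xs →
    π (app g xs) ≡ πHead g xs ∷ []
  π-defined {g} {xs} d cs rewrite d = cong (πHead g xs ∷_) (πs-constructor (nrm S g) cs)

module Instances {S : Signature} {V : Set} (σ : V → Term S ⊥)
                 (σ-constructor : ∀ x → NoDef (σ x)) where

  ⟦_⟧ : Term S V → NTerm S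
  ⟦ t ⟧ = emb (t ⟨ σ ⟩)

  ⟦⟧-args : ∀ (ts : List (Term S V)) → embs (substs ts σ) ≡ map ⟦_⟧ ts
  ⟦⟧-args [] = refl
  ⟦⟧-args (t ∷ ts) = cong (⟦ t ⟧ ∷_) (⟦⟧-args ts)

  ⟦⟧-take : ∀ k (ts : List (Term S V)) → embs (take k (substs ts σ)) ≡ map ⟦_⟧ (take k ts)
  ⟦⟧-take zero ts = refl
  ⟦⟧-take (suc k) [] = refl
  ⟦⟧-take (suc k) (t ∷ ts) = cong (⟦ t ⟧ ∷_) (⟦⟧-take k ts)

  ⊳-image : ∀ {f ts xs a t} → ts ≡ map ⟦_⟧ xs → a ∈ xs → ⟦ a ⟧ ⊵ₙ t → nd f ts ⊳ t
  ⊳-image ts≡ a∈xs = ⊳-∈ (subst (_ ∈_) (sym ts≡) (∈-map⁺ ⟦_⟧ a∈xs))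

  ⟦⟧-⊵ : ∀ {s t : Term S V} → s ⊵ t → ⟦ s ⟧ ⊵ₙ ⟦ t ⟧
  ⟦⟧-⊵ ⊵-refl = ⊵ₙ-refl
  ⟦⟧-⊵ (⊵-arg {ts = ts} i p) = ⊵ₙ-strict (⊳-image (⟦⟧-args ts) (∈-lookup i) (⟦⟧-⊵ p))

  mutual
    instance-constructor : ∀ {t : Term S V} → NoDef t → NoDef (t ⟨ σ ⟩)
    instance-constructor (nd-var {x = x}) = σ-constructor x
    instance-constructor (nd-app c args) = nd-app c (instances-constructor args)

    instances-constructor : ∀ {ts : List (Term S V)} → All NoDef ts → All NoDef (substs ts σ)
    instances-constructor [] = []
    instances-constructor (t ∷ ts) = instance-constructor t ∷ instances-constructor ts

  mutual
    -- Variables are mapped to constructor terms, which contribute nothing to π.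
    length-π≤size : ∀ (t : Term S V) → length (π (t ⟨ σ ⟩)) ≤ size t
    length-π≤size (var x) rewrite π-constructor (σ-constructor x) = z≤n
    length-π≤size (app g ts) with π-app g (substs ts σ)
    ... | inj₁ empty rewrite empty = z≤n
    ... | inj₂ cons rewrite cons = s≤s (length-πs≤sizes (nrm S g) ts)

    length-πs≤sizes : ∀ k (ts : List (Term S V)) → length (πs k (substs ts σ)) ≤ sizes ts
    length-πs≤sizes k [] = z≤n
    length-πs≤sizes zero (t ∷ ts) rewrite length-++ (π (t ⟨ σ ⟩)) {πs zero (substs ts σ)} =
      +-mono-≤ (length-π≤size t) (length-πs≤sizes zero ts)
    length-πs≤sizes (suc k) (t ∷ ts) = ≤-trans (length-πs≤sizes k ts) (m≤n+m _ (size t))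

  ∈-πs : ∀ {u} k (ts : List (Term S V)) → u ∈ πs k (substs ts σ) →
    Σ (Fin (length (drop k ts))) λ j →
      u ∈ π (lookup (drop k ts) j ⟨ σ ⟩) × size (lookup (drop k ts) j) ≤ sizes ts
  ∈-πs zero (t ∷ ts) u∈ with ∈-++⁻ (π (t ⟨ σ ⟩)) u∈
  ... | inj₁ u∈t = Fin.zero , u∈t , m≤m+n (size t) (sizes ts)
  ... | inj₂ u∈ts with ∈-πs zero ts u∈ts
  ...   | j , u∈tj , bound = Fin.suc j , u∈tj , ≤-trans bound (m≤n+m (sizes ts) (size t))
  ∈-πs (suc k) (t ∷ ts) u∈ with ∈-πs k ts u∈
  ... | j , u∈tj , bound = j , u∈tj , ≤-trans bound (m≤n+m (sizes ts) (size t))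

  ∈-π-instance : ∀ {u} g (ts : List (Term S V)) → u ∈ π (app g ts ⟨ σ ⟩) →
    u ≡ πHead g (substs ts σ) ⊎
    Σ (Fin (length (drop (nrm S g) ts))) λ j →
      u ∈ π (lookup (drop (nrm S g) ts) j ⟨ σ ⟩) × size (lookup (drop (nrm S g) ts) j) < size (app g ts)
  ∈-π-instance g ts u∈ with ∈-π-app g (substs ts σ) u∈
  ... | inj₁ u≡head = inj₁ u≡head
  ... | inj₂ u∈safe with ∈-πs (nrm S g) ts u∈safe
  ...   | j , u∈tj , bound = inj₂ (j , u∈tj , s≤s bound)

  -- Facts depending on the precedence ⊐ (which need not be a strict order here).
  module Dominance (_⊐_ : Sym S → Sym S → Set) where
    open POE {S} _⊐_ {V}

    -- Below a constructor term only clause (1) of >poe applies, so >poe is the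
    -- strict subterm relation there; it stays strict after σ and embedding.
    constructor-poe : ∀ {a b} → NoDef a → a >poe b → NoDef b × ⟦ a ⟧ ⊳ ⟦ b ⟧
    constructor-poe (nd-app _ args) (poe1 i (inj₁ refl)) =
      All.lookup args (∈-lookup i) , ⊳-image (⟦⟧-args _) (∈-lookup i) ⊵ₙ-refl
    constructor-poe (nd-app _ args) (poe1 i (inj₂ q)) with constructor-poe (All.lookup args (∈-lookup i)) q
    ... | b-constructor , below = b-constructor , ⊳-image (⟦⟧-args _) (∈-lookup i) (⊵ₙ-strict below)
    constructor-poe (nd-app c _) (poe2 d _ _ _) = ⊥-elim (defined≢constructor {S} d c)
    constructor-poe (nd-app c _) (poe3 d _ _) = ⊥-elim (defined≢constructor {S} d c)

    constructor-poe≥ : ∀ {a b} → NoDef a → a ≥poe b → NoDef b × ⟦ a ⟧ ⊵ₙ ⟦ b ⟧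
    constructor-poe≥ a (inj₁ refl) = a , ⊵ₙ-refl
    constructor-poe≥ a (inj₂ q) with constructor-poe a q
    ... | b , below = b , ⊵ₙ-strict below

    module _ (f : Sym S) (args : List (Term S V)) (args-constructor : All NoDef args) (ℓ′ : ℕ) where
      open Blacktriangle {S} (Lift {S} _⊐_) ℓ′

      -- π(f(args)σ) = [F]; normalArgs are the normal arguments of the rule's left side.
      F : NTerm S
      F = πHead f (substs args σ)

      normalArgs : List (Term S V)
      normalArgs = take (nrm S f) args

      F-above : ∀ g (ts : List (Term S V)) →
        (∀ (j : Fin (length (take (nrm S g) ts))) →
           ∃ λ (i : Fin (length normalArgs)) → lookup normalArgs i ⊵ lookup (take (nrm S g) ts) j) →
        ∀ j → F ⊳ lookup (embs (take (nrm S g) (substs ts σ))) j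
      F-above g ts below j =
        F-above-∈ (subst (lookup gHeadArgs j ∈_) (⟦⟧-take (nrm S g) ts) (∈-lookup j))
        where
          gHeadArgs : List (NTerm S)
          gHeadArgs = embs (take (nrm S g) (substs ts σ))

          F-above-∈ : ∀ {w} → w ∈ map ⟦_⟧ (take (nrm S g) ts) → F ⊳ w
          F-above-∈ w∈ with ∈-map⁻ ⟦_⟧ w∈
          ... | a , a∈ts , refl with below (index a∈ts)
          ...   | i , ai⊵ =
            ⊳-image (⟦⟧-take (nrm S f) args) (∈-lookup i)
                    (subst (λ z → ⟦ lookup normalArgs i ⟧ ⊵ₙ ⟦ z ⟧) (sym (lookup-index a∈ts)) (⟦⟧-⊵ ai⊵))

      normal-count : ∀ g (ts : List (Term S V)) → size (app g ts) ≤ ℓ′ →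
        length (embs (take (nrm S g) (substs ts σ))) ≤ ℓ′
      normal-count g ts bound rewrite ⟦⟧-take (nrm S g) ts | length-map ⟦_⟧ (take (nrm S g) ts)
                                    | length-take (nrm S g) ts =
        ≤-trans (m⊓n≤n (nrm S g) _) (≤-trans (length≤sizes ts) (<⇒≤ bound))

      heads-decrease : ∀ {ts : List (Term S V)} →
        ProdExt _≥poe_ _>poe_ normalArgs (take (nrm S f) ts) →
        ProdExt _⊵ₙ_ _⊳_ (embs (take (nrm S f) (substs args σ))) (embs (take (nrm S f) (substs ts σ)))
      heads-decrease {ts} pe =
        subst₂ (ProdExt _⊵ₙ_ _⊳_) (sym (⟦⟧-take (nrm S f) args)) (sym (⟦⟧-take (nrm S f) ts))
          (ProdExt-map ⟦_⟧ (λ a q → proj₂ (constructor-poe≥ a q)) (λ a q → proj₂ (constructor-poe a q))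
                       (take⁺ (nrm S f) args-constructor) pe)

      dominated : ∀ {t} → app f args >poe t → size t ≤ ℓ′ → ∀ {u} → u ∈ π (t ⟨ σ ⟩) → (F ∷ []) ▶ (u ∷ [])
      dominated {t} (poe1 i q) _ {u} u∈
        with constructor-poe≥ (All.lookup args-constructor (∈-lookup i)) q
      ... | t-constructor , _ =
        ⊥-elim (¬Any[] (subst (u ∈_) (π-constructor (instance-constructor t-constructor)) u∈))
      dominated {app g ts} (poe2 _ f⊐g normal safe) bound u∈ with ∈-π-instance g ts u∈
      ... | inj₁ refl =
        bt1 (norm f⊐g) (F-above g ts normal) (normal-count g ts bound)
      ... | inj₂ (j , u∈tj , smaller) = dominated (safe j) (≤-trans (<⇒≤ smaller) bound) u∈tj
      dominated {app .f ts} (poe3 _ pe safe) bound u∈ with ∈-π-instance f ts u∈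
      ... | inj₁ refl = bt2 (heads-decrease pe)
      ... | inj₂ (j , u∈tj , smaller) = dominated (safe j) (≤-trans (<⇒≤ smaller) bound) u∈tj

      rule-decrease : isDefined S f ≡ true → ∀ {r} → app f args >poe r → size r ≤ ℓ′ →
        π (app f args ⟨ σ ⟩) ▶ π (r ⟨ σ ⟩)
      rule-decrease f-defined {r} l>r bound =
        subst (_▶ π (r ⟨ σ ⟩)) (sym (π-defined f-defined (instances-constructor args-constructor)))
          (bt3 (λ j → dominated l>r bound (∈-lookup j)) (≤-trans (length-π≤size r) bound))

-- The rule's left side is f(args) with constructor arguments; only this shape is used
-- from the TRS assumptions, and values are in particular constructor terms.
lemma6 : (S : Signature) (V : Set) (_⊐_ : Sym S → Sym S → Set) →
    IsStrictPartialOrder _≡_ _⊐_ →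
    (R : List (Rule {S} V)) → CDOC R → Compatible _⊐_ R →
    (σ : V → Term S ⊥) → (∀ x → IsVal (σ x)) →
    ∀ {ρ} → ρ ∈ R →
    π (lhs ρ ⟨ σ ⟩) ▶[ _⊐_ ∣ size (rhs ρ) ] π (rhs ρ ⟨ σ ⟩)
lemma6 S V _⊐_ _ R cdoc compatible σ σ-values {ρ} ρ∈R =
  subst (λ l → π (l ⟨ σ ⟩) ▶[ _⊐_ ∣ size (rhs ρ) ] π (rhs ρ ⟨ σ ⟩)) (sym lhs-shape)
    (rule-decrease root args args-cons (size (rhs ρ)) root-def l>r ≤-refl)
  where
    open ConstructorRule (CDOC.constructorRules cdoc ρ∈R)
    open Instances {S} {V} σ (λ x → proj₂ (σ-values x))
    open Dominance _⊐_

    l>r : POE._>poe_ _⊐_ (app root args) (rhs ρ)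
    l>r = subst (λ l → POE._>poe_ _⊐_ l (rhs ρ)) lhs-shape (compatible ρ∈R)
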